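{- Let $p,r$ be distinct odd primes, $\alpha,\beta,\gamma\geq 1$ integers, and $\Gamma=\mathrm{Cay}(\mathbb{Z}_{p}\times\mathbb{Z}_{2^{\alpha}p^{\beta}r^{\gamma}},\Phi)$ with $\Phi=\varphi_p\times\varphi_{2^{\alpha}p^{\beta}r^{\gamma}}$. Then $\mathrm{diam}(\Gamma)=3$.
   Context: For $n\geq 1$, $\mathbb{Z}_n=\{0,\dots,n-1\}$ is the integers mod $n$ and $\varphi_n$ is the set of elements of $\mathbb{Z}_n$ coprime to $n$ ($\varphi_p=\mathbb{Z}_p\setminus\{0\}$). $\mathrm{Cay}(\mathbb{Z}_p\times\mathbb{Z}_m,\varphi_p\times\varphi_m)$ is the graph on $\mathbb{Z}_p\times\mathbb{Z}_m$ where $(u,v)\sim(u',v')$ iff $u-u'\in\varphi_p$ and $v-v'\in\varphi_m$. -}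

module Defs where

open import Data.Nat using (ℕ; zero; suc; _+_; _∸_; _^_; _≤_; _%_; NonZero)
open import Data.Nat.Coprimality using (Coprime)
open import Data.Nat.Primality using (Prime)
open import Data.Fin using (Fin; toℕ)
open import Data.Product using (_×_; _,_; ∃; ∃-syntax)
open import Relation.Nullary using (¬_)

diffMod : (n : ℕ) .{{_ : NonZero n}} → Fin n → Fin n → ℕ
diffMod n a b = (toℕ a + n ∸ toℕ b) % n

-- x ∈ φ_n : x is coprime to n
-- Adjacency in Cay(Z_p × Z_m, φ_p × φ_m)
CayAdj : (p m : ℕ) .{{_ : NonZero p}} .{{_ : NonZero m}} →
         (Fin p × Fin m) → (Fin p × Fin m) → Set
CayAdj p m (u , v) (u' , v') = Coprime (diffMod p u u') p × Coprime (diffMod m v v') m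

data Walk {V : Set} (Adj : V → V → Set) : ℕ → V → V → Set where
  here : ∀ {x} → Walk Adj zero x x
  step : ∀ {k x y z} → Adj x y → Walk Adj k y z → Walk Adj (suc k) x z

DistLE : {V : Set} (Adj : V → V → Set) → ℕ → V → V → Set
DistLE Adj d x y = ∃[ k ] (k ≤ d × Walk Adj k x y)

Diameter : {V : Set} (Adj : V → V → Set) → ℕ → Set
Diameter Adj zero = ∀ x y → DistLE Adj zero x y
Diameter Adj (suc d) = (∀ x y → DistLE Adj (suc d) x y) × (∃[ x ] ∃[ y ] ¬ DistLE Adj d x y)

-- Write the difference of two vertices as (Δu, Δv). Every integer is a sum of two residues prime to
-- the odd prime p, and every even integer is a sum of two integers prime to 2, p and r, i.e. to
-- m = 2^α p^β r^γ. So an even Δv is covered by a walk of length 2, and an odd Δv by a first step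
-- (1, 1) followed by such a walk. Conversely, a single step changes the first coordinate, and two
-- steps change the second one by a sum of two odd numbers; hence (0, 1) and (0, 0) are at distance 3.

module Submission where

open import Defs
open import Data.Nat using (ℕ; zero; suc; _*_; _^_; _≤_; _<_; _%_; NonZero; NonTrivial; s≤s; z≤n)
import Data.Nat as ℕ
import Data.Nat.Properties as ℕ
open import Data.Nat.Divisibility as ℕ∣ using () renaming (_∣_ to _∣ℕ_)
open import Data.Nat.Coprimality using (Coprime; 1-coprimeTo; ¬0-coprimeTo-2+; coprime-divisor)
open import Data.Nat.Primality using (Prime; prime[2]; prime⇒irreducible; prime⇒nonTrivial; euclidsLemma)
open import Data.Integer using (ℤ; +_; _+_; _-_; 0ℤ; 1ℤ; ∣_∣)
import Data.Integer as ℤ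
import Data.Integer.Properties as ℤ
open import Data.Integer.DivMod using (_%ℕ_; _/ℕ_; n%ℕd<d; a≡a%ℕn+[a/ℕn]*n)
open import Data.Integer.Divisibility.Signed
  using (_∣_; divides; _∣?_; ∣⇒∣ᵤ; ∣ᵤ⇒∣; ∣m⇒∣-m; ∣m∣n⇒∣m+n; ∣-trans)
open import Data.Integer.Tactic.RingSolver using (solve-∀)
open import Data.Fin using (Fin; toℕ; fromℕ<)
open import Data.Fin.Properties using (toℕ-fromℕ<; toℕ<n)
open import Data.Product using (_×_; _,_; proj₁; proj₂; ∃-syntax; ∃₂)
open import Data.Sum using (_⊎_; inj₁; inj₂)
open import Data.Empty using (⊥; ⊥-elim)
open import Relation.Nullary using (¬_; Dec; yes; no)
open import Relation.Nullary.Decidable using (map′)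
open import Relation.Binary.PropositionalEquality
  using (_≡_; _≢_; refl; sym; trans; cong; cong₂; subst)

-- Coprimality in ℕ

coprime-* : ∀ {k n m} → Coprime k n → Coprime k m → Coprime k (n * m)
coprime-* {k} {n} k⊥n k⊥m {d} (d∣k , d∣nm) = k⊥m (d∣k , coprime-divisor d⊥n d∣nm)
  where
    d⊥n : Coprime d n
    d⊥n (e∣d , e∣n) = k⊥n (ℕ∣.∣-trans e∣d d∣k , e∣n)

coprime-^ : ∀ {k n} → Coprime k n → ∀ i → Coprime k (n ^ i)
coprime-^ k⊥n zero    (_ , d∣1) = ℕ∣.∣1⇒≡1 d∣1
coprime-^ k⊥n (suc i) = coprime-* k⊥n (coprime-^ k⊥n i)

¬∣⇒coprime : ∀ {q n} → Prime q → ¬ q ∣ℕ n → Coprime n q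
¬∣⇒coprime q-prime q∤n (d∣n , d∣q) with prime⇒irreducible q-prime d∣q
... | inj₁ d≡1 = d≡1
... | inj₂ refl = ⊥-elim (q∤n d∣n)

prime∤* : ∀ {q m n} → Prime q → ¬ q ∣ℕ m → ¬ q ∣ℕ n → ¬ q ∣ℕ m * n
prime∤* {m = m} {n} q-prime q∤m q∤n q∣mn with euclidsLemma m n q-prime q∣mn
... | inj₁ q∣m = q∤m q∣m
... | inj₂ q∣n = q∤n q∣n

distinct-primes∤ : ∀ {p q} → Prime p → Prime q → p ≢ q → ¬ p ∣ℕ q
distinct-primes∤ p-prime q-prime p≢q p∣q with prime⇒irreducible q-prime p∣q
... | inj₁ refl = ℕ.nonTrivial⇒≢1 {{prime⇒nonTrivial p-prime}} refl
... | inj₂ p≡q = p≢q p≡q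

odd-prime∤2 : ∀ {q} → Prime q → q % 2 ≡ 1 → ¬ q ∣ℕ 2
odd-prime∤2 q-prime q-odd q∣2 with prime⇒irreducible prime[2] q∣2
... | inj₁ refl = ℕ.nonTrivial⇒≢1 {{prime⇒nonTrivial q-prime}} refl
... | inj₂ refl with q-odd
... | ()

-- Congruences of integers modulo a natural number

infix 4 _≡_mod_

record _≡_mod_ (a b : ℤ) (n : ℕ) : Set where
  constructor ≡-mod
  field n∣a-b : + n ∣ a - b

open _≡_mod_

≡⇒≡-mod : ∀ {a b n} → a ≡ b → a ≡ b mod n
≡⇒≡-mod {a} refl = ≡-mod (divides 0ℤ (ℤ.+-inverseʳ a))

≡-mod-sym : ∀ {a b n} → a ≡ b mod n → b ≡ a mod n
≡-mod-sym {a} {b} {n} (≡-mod n∣a-b) = ≡-mod (subst (+ n ∣_) (negate-sub a b) (∣m⇒∣-m n∣a-b))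
  where
    negate-sub : ∀ a b → ℤ.- (a - b) ≡ b - a
    negate-sub = solve-∀

≡-mod-trans : ∀ {a b c n} → a ≡ b mod n → b ≡ c mod n → a ≡ c mod n
≡-mod-trans {a} {b} {c} {n} (≡-mod n∣a-b) (≡-mod n∣b-c) =
  ≡-mod (subst (+ n ∣_) (telescope a b c) (∣m∣n⇒∣m+n n∣a-b n∣b-c))
  where
    telescope : ∀ a b c → (a - b) + (b - c) ≡ a - c
    telescope = solve-∀

≡-mod-+ : ∀ {a b c d n} → a ≡ b mod n → c ≡ d mod n → a + c ≡ b + d mod n
≡-mod-+ {a} {b} {c} {d} {n} (≡-mod n∣a-b) (≡-mod n∣c-d) =
  ≡-mod (subst (+ n ∣_) (regroup a b c d) (∣m∣n⇒∣m+n n∣a-b n∣c-d))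
  where
    regroup : ∀ a b c d → (a - b) + (c - d) ≡ (a + c) - (b + d)
    regroup = solve-∀

≡-mod-neg : ∀ {a b n} → a ≡ b mod n → ℤ.- a ≡ ℤ.- b mod n
≡-mod-neg {a} {b} {n} (≡-mod n∣a-b) = ≡-mod (subst (+ n ∣_) (regroup a b) (∣m⇒∣-m n∣a-b))
  where
    regroup : ∀ a b → ℤ.- (a - b) ≡ ℤ.- a - ℤ.- b
    regroup = solve-∀

≡-mod-- : ∀ {a b c d n} → a ≡ b mod n → c ≡ d mod n → a - c ≡ b - d mod n
≡-mod-- a≡b c≡d = ≡-mod-+ a≡b (≡-mod-neg c≡d)

≡-mod-∣ : ∀ {a b q n} → q ∣ℕ n → a ≡ b mod n → a ≡ b mod q
≡-mod-∣ q∣n (≡-mod n∣a-b) = ≡-mod (∣-trans (∣ᵤ⇒∣ q∣n) n∣a-b)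

+n≡-mod : ∀ a n → a + + n ≡ a mod n
+n≡-mod a n = ≡-mod (divides 1ℤ (cancel a (+ n)))
  where
    cancel : ∀ a n → (a + n) - a ≡ 1ℤ ℤ.* n
    cancel = solve-∀

%ℕ≡-mod : ∀ z n .{{_ : NonZero n}} → + (z %ℕ n) ≡ z mod n
%ℕ≡-mod z n = ≡-mod (divides (ℤ.- (z /ℕ n)) (begin
  + (z %ℕ n) - z                          ≡⟨ cong (+ (z %ℕ n) -_) (a≡a%ℕn+[a/ℕn]*n z n) ⟩
  + (z %ℕ n) - (+ (z %ℕ n) + z /ℕ n ℤ.* + n) ≡⟨ cancel (+ (z %ℕ n)) (z /ℕ n) (+ n) ⟩
  ℤ.- (z /ℕ n) ℤ.* + n                    ∎))
  where
    open Relation.Binary.PropositionalEquality.≡-Reasoning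
    cancel : ∀ r q n → r - (r + q ℤ.* n) ≡ ℤ.- q ℤ.* n
    cancel = solve-∀

∣⇒≡0-mod : ∀ {n z} → + n ∣ z → z ≡ 0ℤ mod n
∣⇒≡0-mod {n} {z} n∣z = ≡-mod (subst (+ n ∣_) (sym (ℤ.+-identityʳ z)) n∣z)

≡0-mod⇒∣ : ∀ {z n} → z ≡ 0ℤ mod n → + n ∣ z
≡0-mod⇒∣ {z} {n} (≡-mod n∣z-0) = subst (+ n ∣_) (ℤ.+-identityʳ z) n∣z-0

≡-mod? : ∀ a b n → Dec (a ≡ b mod n)
≡-mod? a b n = map′ ≡-mod n∣a-b (+ n ∣? a - b)

≢-mod-respˡ : ∀ {a b c n} → a ≡ b mod n → ¬ b ≡ c mod n → ¬ a ≡ c mod n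
≢-mod-respˡ a≡b b≢c a≡c = b≢c (≡-mod-trans (≡-mod-sym a≡b) a≡c)

1≢0-mod-2 : ¬ 1ℤ ≡ 0ℤ mod 2
1≢0-mod-2 (≡-mod 2∣1) with ℕ∣.∣1⇒≡1 (∣⇒∣ᵤ 2∣1)
... | ()

parity : ∀ z → z ≡ 0ℤ mod 2 ⊎ z ≡ 1ℤ mod 2
parity z with z %ℕ 2 | n%ℕd<d z 2 | %ℕ≡-mod z 2
... | 0 | _ | 0≡z = inj₁ (≡-mod-sym 0≡z)
... | 1 | _ | 1≡z = inj₂ (≡-mod-sym 1≡z)
... | suc (suc _) | s≤s (s≤s ()) | _

coprime-respects-≡-mod : ∀ {a b n} → a ≡ b mod n → Coprime (∣ a ∣) n → Coprime (∣ b ∣) n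
coprime-respects-≡-mod a≡b a⊥n (d∣b , d∣n) =
  a⊥n (∣⇒∣ᵤ (≡0-mod⇒∣ (≡-mod-trans (≡-mod-∣ d∣n a≡b) (∣⇒≡0-mod (∣ᵤ⇒∣ d∣b)))) , d∣n)

coprime⇒≢0-mod : ∀ {d n z} → d ∣ℕ n → d ≢ 1 → Coprime (∣ z ∣) n → ¬ z ≡ 0ℤ mod d
coprime⇒≢0-mod d∣n d≢1 z⊥n z≡0 = d≢1 (z⊥n (∣⇒∣ᵤ (≡0-mod⇒∣ z≡0) , d∣n))

≢0-mod⇒coprime : ∀ {p z} → Prime p → ¬ z ≡ 0ℤ mod p → Coprime (∣ z ∣) p
≢0-mod⇒coprime p-prime z≢0 = ¬∣⇒coprime p-prime (λ p∣z → z≢0 (∣⇒≡0-mod (∣ᵤ⇒∣ p∣z)))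

coprime-2^α*p^β*r^γ : ∀ {p r z} α β γ → Prime p → Prime r →
  ¬ z ≡ 0ℤ mod 2 → ¬ z ≡ 0ℤ mod p → ¬ z ≡ 0ℤ mod r → Coprime (∣ z ∣) (2 ^ α * p ^ β * r ^ γ)
coprime-2^α*p^β*r^γ α β γ p-prime r-prime z≢0[2] z≢0[p] z≢0[r] =
  coprime-* (coprime-* (coprime-^ (≢0-mod⇒coprime prime[2] z≢0[2]) α)
                       (coprime-^ (≢0-mod⇒coprime p-prime z≢0[p]) β))
            (coprime-^ (≢0-mod⇒coprime r-prime z≢0[r]) γ)

-- Writing an integer as a sum of two units

-- Of c, c + K, c + 2K, two lying in the same forbidden class would differ by K or 2K.
avoid-two-classes : ∀ {q K} → ¬ q ∣ℕ 2 * K → ∀ a b c →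
  ∃[ c′ ] c′ ≡ c mod K × ¬ c′ ≡ a mod q × ¬ c′ ≡ b mod q
avoid-two-classes {q} {K} q∤2K a b c = pick (classify c) (classify c₁) (classify c₂)
  where
    c₁ c₂ : ℤ
    c₁ = c + + K
    c₂ = c₁ + + K

    Bad : ℤ → Set
    Bad x = x ≡ a mod q ⊎ x ≡ b mod q

    Good : ℤ → Set
    Good x = ¬ x ≡ a mod q × ¬ x ≡ b mod q

    classify : ∀ x → Bad x ⊎ Good x
    classify x with ≡-mod? x a q | ≡-mod? x b q
    ... | yes x≡a | _       = inj₁ (inj₁ x≡a)
    ... | no _    | yes x≡b = inj₁ (inj₂ x≡b)
    ... | no x≢a  | no x≢b  = inj₂ (x≢a , x≢b)

    apart : ∀ {j} x y → y - x ≡ + j → ¬ q ∣ℕ j → ¬ y ≡ x mod q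
    apart {j} x y y-x≡j q∤j (≡-mod q∣y-x) = q∤j (∣⇒∣ᵤ (subst (+ q ∣_) y-x≡j q∣y-x))

    q∤K : ¬ q ∣ℕ K
    q∤K q∣K = q∤2K (ℕ∣.∣n⇒∣m*n 2 q∣K)

    shift : ∀ x k → (x + k) - x ≡ k
    shift = solve-∀

    double-shift : ∀ x k → ((x + k) + k) - x ≡ + 2 ℤ.* k
    double-shift = solve-∀

    apart₀₁ : ¬ c₁ ≡ c mod q
    apart₀₁ = apart c c₁ (shift c (+ K)) q∤K

    apart₁₂ : ¬ c₂ ≡ c₁ mod q
    apart₁₂ = apart c₁ c₂ (shift c₁ (+ K)) q∤K

    apart₀₂ : ¬ c₂ ≡ c mod q
    apart₀₂ = apart c c₂ (trans (double-shift c (+ K)) (sym (ℤ.pos-* 2 K))) q∤2K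

    pigeonhole : Bad c → Bad c₁ → Bad c₂ → ⊥
    pigeonhole (inj₁ h₀) (inj₁ h₁) _         = apart₀₁ (≡-mod-trans h₁ (≡-mod-sym h₀))
    pigeonhole (inj₂ h₀) (inj₂ h₁) _         = apart₀₁ (≡-mod-trans h₁ (≡-mod-sym h₀))
    pigeonhole _         (inj₁ h₁) (inj₁ h₂) = apart₁₂ (≡-mod-trans h₂ (≡-mod-sym h₁))
    pigeonhole _         (inj₂ h₁) (inj₂ h₂) = apart₁₂ (≡-mod-trans h₂ (≡-mod-sym h₁))
    pigeonhole (inj₁ h₀) (inj₂ _)  (inj₁ h₂) = apart₀₂ (≡-mod-trans h₂ (≡-mod-sym h₀))
    pigeonhole (inj₂ h₀) (inj₁ _)  (inj₂ h₂) = apart₀₂ (≡-mod-trans h₂ (≡-mod-sym h₀))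

    pick : Bad c ⊎ Good c → Bad c₁ ⊎ Good c₁ → Bad c₂ ⊎ Good c₂ →
           ∃[ c′ ] c′ ≡ c mod K × Good c′
    pick (inj₂ good) _ _ = c , ≡⇒≡-mod refl , good
    pick _ (inj₂ good) _ = c₁ , +n≡-mod c K , good
    pick _ _ (inj₂ good) = c₂ , ≡-mod-trans (+n≡-mod c₁ K) (+n≡-mod c K) , good
    pick (inj₁ bad₀) (inj₁ bad₁) (inj₁ bad₂) = ⊥-elim (pigeonhole bad₀ bad₁ bad₂)

SumOfTwoUnits : ℕ → ℤ → Set
SumOfTwoUnits n z = ∃₂ λ a b → Coprime (∣ a ∣) n × Coprime (∣ b ∣) n × z ≡ a + b

≢⇒sub≢0-mod : ∀ {a b n} → ¬ a ≡ b mod n → ¬ b - a ≡ 0ℤ mod n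
≢⇒sub≢0-mod a≢b b-a≡0 = a≢b (≡-mod-sym (≡-mod (≡0-mod⇒∣ b-a≡0)))

z≡c+[z-c] : ∀ z c → z ≡ c + (z - c)
z≡c+[z-c] = solve-∀

sumOfTwoUnits-odd-prime : ∀ {p} → Prime p → ¬ p ∣ℕ 2 → ∀ z → SumOfTwoUnits p z
sumOfTwoUnits-odd-prime p-prime p∤2 z with avoid-two-classes {K = 1} p∤2 0ℤ z 0ℤ
... | c , _ , c≢0 , c≢z =
  c , z - c , ≢0-mod⇒coprime p-prime c≢0 , ≢0-mod⇒coprime p-prime (≢⇒sub≢0-mod c≢z) , z≡c+[z-c] z c

-- c is odd and avoids 0 and z modulo p; moving it by multiples of 2p keeps that and avoids 0 and z modulo r.
sumOfTwoUnits-even : ∀ {p r} α β γ → Prime p → Prime r → ¬ p ∣ℕ 2 → ¬ r ∣ℕ 2 → r ≢ p →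
  ∀ z → z ≡ 0ℤ mod 2 → SumOfTwoUnits (2 ^ α * p ^ β * r ^ γ) z
sumOfTwoUnits-even {p} {r} α β γ p-prime r-prime p∤2 r∤2 r≢p z z≡0[2]
  with avoid-two-classes {p} {2} (prime∤* p-prime p∤2 p∤2) 0ℤ z 1ℤ
... | c , c≡1[2] , c≢0[p] , c≢z[p]
  with avoid-two-classes {r} {2 * p}
         (prime∤* r-prime r∤2 (prime∤* r-prime r∤2 (distinct-primes∤ r-prime p-prime r≢p))) 0ℤ z c
... | c′ , c′≡c[2p] , c′≢0[r] , c′≢z[r] =
  c′ , z - c′ ,
  unit (≢-mod-respˡ c′≡1[2] 1≢0-mod-2) (≢-mod-respˡ c′≡c[p] c≢0[p]) c′≢0[r] ,
  unit z-c′≢0[2] (≢⇒sub≢0-mod (≢-mod-respˡ c′≡c[p] c≢z[p])) (≢⇒sub≢0-mod c′≢z[r]) ,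
  z≡c+[z-c] z c′
  where
    unit : ∀ {x} → ¬ x ≡ 0ℤ mod 2 → ¬ x ≡ 0ℤ mod p → ¬ x ≡ 0ℤ mod r →
           Coprime (∣ x ∣) (2 ^ α * p ^ β * r ^ γ)
    unit = coprime-2^α*p^β*r^γ α β γ p-prime r-prime

    c′≡c[p] : c′ ≡ c mod p
    c′≡c[p] = ≡-mod-∣ (ℕ∣.n∣m*n 2) c′≡c[2p]

    c′≡1[2] : c′ ≡ 1ℤ mod 2
    c′≡1[2] = ≡-mod-trans (≡-mod-∣ (ℕ∣.m∣m*n p) c′≡c[2p]) c≡1[2]

    z-c′≢0[2] : ¬ z - c′ ≡ 0ℤ mod 2
    z-c′≢0[2] z-c′≡0 = 1≢0-mod-2 (≡-mod-neg (≡-mod-trans (≡-mod-sym (≡-mod-- z≡0[2] c′≡1[2])) z-c′≡0))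

-- Differences in ℤₙ

δ : ∀ {n} → Fin n → Fin n → ℤ
δ a b = + toℕ a - + toℕ b

δ-trans : ∀ {n} (a b c : Fin n) → δ a c ≡ δ a b + δ b c
δ-trans a b c = telescope (+ toℕ a) (+ toℕ b) (+ toℕ c)
  where
    telescope : ∀ x y z → x - z ≡ (x - y) + (y - z)
    telescope = solve-∀

diffMod≡δ : ∀ n .{{_ : NonZero n}} (a b : Fin n) → + diffMod n a b ≡ δ a b mod n
diffMod≡δ n a b =
  ≡-mod-trans (%ℕ≡-mod (+ (toℕ a ℕ.+ n ℕ.∸ toℕ b)) n)
    (≡-mod-trans (≡⇒≡-mod lift-∸) (+n≡-mod (δ a b) n))
  where
    open Relation.Binary.PropositionalEquality.≡-Reasoning
    A = toℕ a
    B = toℕ b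
    B≤A+n : B ≤ A ℕ.+ n
    B≤A+n = ℕ.≤-trans (ℕ.<⇒≤ (toℕ<n b)) (ℕ.m≤n+m n A)
    regroup : ∀ x y z → (x + z) - y ≡ (x - y) + z
    regroup = solve-∀
    lift-∸ : + (A ℕ.+ n ℕ.∸ B) ≡ δ a b + + n
    lift-∸ = begin
      + (A ℕ.+ n ℕ.∸ B)      ≡⟨ sym (ℤ.⊖-≥ B≤A+n) ⟩
      (A ℕ.+ n) ℤ.⊖ B        ≡⟨ sym (ℤ.m-n≡m⊖n (A ℕ.+ n) B) ⟩
      + (A ℕ.+ n) - + B      ≡⟨ cong (_- + B) (ℤ.pos-+ A n) ⟩
      (+ A + + n) - + B      ≡⟨ regroup (+ A) (+ B) (+ n) ⟩
      δ a b + + n            ∎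

δ-exists : ∀ n .{{_ : NonZero n}} (a : Fin n) e → ∃[ b ] δ a b ≡ e mod n
δ-exists n a e =
  b , ≡-mod-trans (≡-mod-- (≡⇒≡-mod {+ toℕ a} refl) b≡a-e) (≡⇒≡-mod (cancel (+ toℕ a) e))
  where
    b : Fin n
    b = fromℕ< (n%ℕd<d (+ toℕ a - e) n)
    b≡a-e : + toℕ b ≡ + toℕ a - e mod n
    b≡a-e = subst (λ k → + k ≡ + toℕ a - e mod n) (sym (toℕ-fromℕ< _)) (%ℕ≡-mod (+ toℕ a - e) n)
    cancel : ∀ x e → x - (x - e) ≡ e
    cancel = solve-∀

δ-cancel : ∀ {n e e′} {a b c : Fin n} → δ a c ≡ e + e′ mod n → δ a b ≡ e mod n → δ b c ≡ e′ mod n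
δ-cancel {e = e} {e′} {a} {b} {c} δac≡ δab≡ =
  ≡-mod-trans (≡⇒≡-mod (difference (δ a b) (δ b c)))
    (≡-mod-trans (≡-mod-- (≡-mod-trans (≡⇒≡-mod (sym (δ-trans a b c))) δac≡) δab≡)
                 (≡⇒≡-mod (sym (difference e e′))))
  where
    difference : ∀ x y → y ≡ (x + y) - x
    difference = solve-∀

-- Walks in Cay(ℤₙ × ℤₘ, φₙ × φₘ)

module _ {n m : ℕ} .{{_ : NonZero n}} .{{_ : NonZero m}} where

  private
    Γ : Fin n × Fin m → Fin n × Fin m → Set
    Γ = CayAdj n m

  adjacent⇒coprime : ∀ {u u′ v v′} → Γ (u , v) (u′ , v′) →
                     Coprime (∣ δ u u′ ∣) n × Coprime (∣ δ v v′ ∣) m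
  adjacent⇒coprime {u} {u′} {v} {v′} (u⊥n , v⊥m) =
    coprime-respects-≡-mod (diffMod≡δ n u u′) u⊥n ,
    coprime-respects-≡-mod (diffMod≡δ m v v′) v⊥m

  adjacent : ∀ {u u′ v v′ e f} → Coprime (∣ e ∣) n → Coprime (∣ f ∣) m →
             δ u u′ ≡ e mod n → δ v v′ ≡ f mod m → Γ (u , v) (u′ , v′)
  adjacent {u} {u′} {v} {v′} e⊥n f⊥m δu≡e δv≡f =
    coprime-respects-≡-mod (≡-mod-sym (≡-mod-trans (diffMod≡δ n u u′) δu≡e)) e⊥n ,
    coprime-respects-≡-mod (≡-mod-sym (≡-mod-trans (diffMod≡δ m v v′) δv≡f)) f⊥m

  walk-suc : ∀ {k u u′ v v′ e e′ f f′} → Coprime (∣ e ∣) n → Coprime (∣ f ∣) m →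
             δ u u′ ≡ e + e′ mod n → δ v v′ ≡ f + f′ mod m →
             (∀ {w t} → δ w u′ ≡ e′ mod n → δ t v′ ≡ f′ mod m → Walk Γ k (w , t) (u′ , v′)) →
             Walk Γ (suc k) (u , v) (u′ , v′)
  walk-suc {u = u} {u′} {v} {v′} {e} {e′} {f} {f′} e⊥n f⊥m δu≡ δv≡ rest
    with δ-exists n u e | δ-exists m v f
  ... | w , δuw≡e | t , δvt≡f =
    step {y = w , t} (adjacent {u} {w} {v} {t} e⊥n f⊥m δuw≡e δvt≡f)
      (rest (δ-cancel {a = u} {w} {u′} δu≡ δuw≡e) (δ-cancel {a = v} {t} {v′} δv≡ δvt≡f))

  walk₂ : ∀ {u u′ v v′ e f} → SumOfTwoUnits n e → SumOfTwoUnits m f →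
          δ u u′ ≡ e mod n → δ v v′ ≡ f mod m → Walk Γ 2 (u , v) (u′ , v′)
  walk₂ {u} {u′} {v} {v′} (e₁ , e₂ , e₁⊥n , e₂⊥n , e≡) (f₁ , f₂ , f₁⊥m , f₂⊥m , f≡) δu≡e δv≡f =
    walk-suc {e = e₁} {e₂} {f₁} {f₂} e₁⊥n f₁⊥m
      (≡-mod-trans δu≡e (≡⇒≡-mod e≡)) (≡-mod-trans δv≡f (≡⇒≡-mod f≡))
      (λ {w} {t} δw≡ δt≡ → step (adjacent {w} {u′} {t} {v′} e₂⊥n f₂⊥m δw≡ δt≡) here)

  walk₃ : ∀ {u u′ v v′} → SumOfTwoUnits n (δ u u′ - 1ℤ) → SumOfTwoUnits m (δ v v′ - 1ℤ) →
          Walk Γ 3 (u , v) (u′ , v′)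
  walk₃ {u} {u′} {v} {v′} sumₙ sumₘ =
    walk-suc {e = 1ℤ} {δ u u′ - 1ℤ} {1ℤ} {δ v v′ - 1ℤ} (1-coprimeTo n) (1-coprimeTo m)
      (≡⇒≡-mod (z≡c+[z-c] (δ u u′) 1ℤ)) (≡⇒≡-mod (z≡c+[z-c] (δ v v′) 1ℤ))
      (λ {w} {t} → walk₂ {w} {u′} {t} {v′} sumₙ sumₘ)

  distance≤3 : (∀ z → SumOfTwoUnits n z) → (∀ z → z ≡ 0ℤ mod 2 → SumOfTwoUnits m z) →
               ∀ x y → DistLE Γ 3 x y
  distance≤3 sumₙ sumₘ (u , v) (u′ , v′) with parity (δ v v′)
  ... | inj₁ even = 2 , s≤s (s≤s z≤n) , walk₂ (sumₙ _) (sumₘ _ even) (≡⇒≡-mod refl) (≡⇒≡-mod refl)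
  ... | inj₂ odd  = 3 , ℕ.≤-refl , walk₃ (sumₙ _) (sumₘ _ (≡-mod-- odd (≡⇒≡-mod {1ℤ} refl)))

  distance>2 : NonTrivial n → 2 ∣ℕ m → ∀ u {v v′} → ¬ δ v v′ ≡ 0ℤ mod 2 →
               ¬ DistLE Γ 2 (u , v) (u , v′)
  distance>2 _ _ u {v} δ≢0 (0 , _ , here) = δ≢0 (≡⇒≡-mod (ℤ.+-inverseʳ (+ toℕ v)))
  distance>2 n-nontrivial _ u {v} {v′} _ (1 , _ , step adj here) =
    ¬0-coprimeTo-2+ {{n-nontrivial}} (subst (λ z → Coprime z n) (cong ∣_∣ (ℤ.+-inverseʳ (+ toℕ u)))
                                            (proj₁ (adjacent⇒coprime {u} {u} {v} {v′} adj)))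
  distance>2 _ 2∣m u {v} {v′} δ≢0 (2 , _ , step {y = w , t} adj₁ (step adj₂ here)) =
    δ≢0 (≡-mod-trans (≡⇒≡-mod (δ-trans v t v′))
          (≡-mod-trans (≡-mod-+ (odd {δ v t} (proj₂ (adjacent⇒coprime {u} {w} {v} {t} adj₁)))
                                (odd {δ t v′} (proj₂ (adjacent⇒coprime {w} {u} {t} {v′} adj₂))))
                       (+n≡-mod 0ℤ 2)))
    where
      odd : ∀ {x} → Coprime (∣ x ∣) m → x ≡ 1ℤ mod 2
      odd {x} x⊥m with parity x
      ... | inj₁ even = ⊥-elim (coprime⇒≢0-mod 2∣m (λ ()) x⊥m even)
      ... | inj₂ odd′ = odd′
  distance>2 _ _ _ _ (suc (suc (suc _)) , s≤s (s≤s ()) , _)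

proposition4p3 : (p r α β γ : ℕ) → Prime p → Prime r → p % 2 ≡ 1 → r % 2 ≡ 1 → p ≢ r →
    1 ≤ α → 1 ≤ β → 1 ≤ γ →
    .{{_ : NonZero p}} .{{_ : NonZero (2 ^ α * p ^ β * r ^ γ)}} →
    Diameter (CayAdj p (2 ^ α * p ^ β * r ^ γ)) 3
proposition4p3 p r (suc α) β γ p-prime r-prime p-odd r-odd p≢r (s≤s z≤n) _ _ =
  distance≤3 (sumOfTwoUnits-odd-prime p-prime p∤2)
             (sumOfTwoUnits-even (suc α) β γ p-prime r-prime p∤2 r∤2 (λ r≡p → p≢r (sym r≡p))) ,
  (u₀ , v₁) , (u₀ , v₀) , distance>2 (prime⇒nonTrivial p-prime) 2∣m u₀ δv₁v₀≢0
  where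
    m = 2 ^ suc α * p ^ β * r ^ γ
    p∤2 = odd-prime∤2 p-prime p-odd
    r∤2 = odd-prime∤2 r-prime r-odd

    2∣m : 2 ∣ℕ m
    2∣m = ℕ∣.∣m⇒∣m*n (r ^ γ) (ℕ∣.∣m⇒∣m*n (p ^ β) (ℕ∣.m∣m*n (2 ^ α)))

    1<m : 1 < m
    1<m = ℕ∣.∣⇒≤ 2∣m

    0<m : 0 < m
    0<m = ℕ.<-trans (s≤s z≤n) 1<m

    u₀ : Fin p
    u₀ = fromℕ< (ℕ.>-nonZero⁻¹ p)

    v₀ v₁ : Fin m
    v₀ = fromℕ< 0<m
    v₁ = fromℕ< 1<m

    δv₁v₀≡1 : δ v₁ v₀ ≡ 1ℤ
    δv₁v₀≡1 = cong₂ (λ i j → + i - + j) (toℕ-fromℕ< 1<m) (toℕ-fromℕ< 0<m)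

    δv₁v₀≢0 : ¬ δ v₁ v₀ ≡ 0ℤ mod 2
    δv₁v₀≢0 = ≢-mod-respˡ (≡⇒≡-mod δv₁v₀≡1) 1≢0-mod-2
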